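{- Let $p\neq q$ be primes, let $\mathbf P$ be a finite abelian $p$-group and $\mathbf Q$ a finite abelian $q$-group, and let $\mathbf G=\mathbf P\times\mathbf Q$. Let $b\in Q$, $b\neq e$, with $o(b)=q^u$. Then the neighborhood class of $(e,b)$ in $\mathcal D(\mathbf G)$ is $[(e,b)]=\{(e,y) : y\in Q,\ o(y)=q^u,\ |\langle b\rangle\cap\langle y\rangle|\geq q^{u-1}\}$.
   Context: $e$ denotes the identity element and $o(x)$ the order of $x$. The power graph of a group $\mathbf K$ is the simple graph on $K$ in which two distinct elements are adjacent iff one is a power of the other; the enhanced power graph of $\mathbf K$ is the simple graph on $K$ in which two distinct elements are adjacent iff they generate a cyclic subgroup. The difference graph $\mathcal D(\mathbf K)$ is the graph whose edges are the pairs adjacent in the enhanced power graph but not in the power graph, with all isolated vertices removed. For a vertex $v$ of a graph, its neighborhood class $[v]$ is the set of all vertices having the same neighborhood as $v$. -}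

module Defs where

open import Level using (Level; _⊔_)
open import Data.Nat using (ℕ; zero; suc; _<_; _^_)
open import Data.Fin using (Fin)
open import Data.List using (List)
open import Data.List.Membership.Setoid using () renaming (_∈_ to _∈ₛ_)
open import Data.Product using (Σ; ∃; _×_; _,_)
open import Data.Sum using (_⊎_)
open import Relation.Nullary using (¬_)
open import Relation.Binary.PropositionalEquality using (_≡_)
open import Algebra.Bundles using (Group; AbelianGroup)

module GroupNotions {c ℓ : Level} (G : Group c ℓ) where
  open Group G

  pow : Carrier → ℕ → Carrier
  pow x zero    = ε
  pow x (suc n) = x ∙ pow x n

  IsFinite : Set (c ⊔ ℓ)
  IsFinite = Σ (List Carrier) λ xs → ∀ x → _∈ₛ_ setoid x xs

  HasOrder : Carrier → ℕ → Set ℓ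
  HasOrder x n = (0 < n) × (pow x n ≈ ε) × (∀ m → 0 < m → m < n → ¬ (pow x m ≈ ε))

  IsPGroup : ℕ → Set (c ⊔ ℓ)
  IsPGroup p = ∀ x → ∃ λ k → HasOrder x (p ^ k)

  -- membership in the cyclic subgroup <x> (in a finite group <x> = {x^n : n ∈ ℕ})
  _∈⟨_⟩ : Carrier → Carrier → Set ℓ
  y ∈⟨ x ⟩ = ∃ λ n → y ≈ pow x n

  AtLeast : (Carrier → Set ℓ) → ℕ → Set (c ⊔ ℓ)
  AtLeast S k = Σ (Fin k → Carrier) λ f → (∀ i → S (f i)) × (∀ i j → f i ≈ f j → i ≡ j)

  PowAdj : Carrier → Carrier → Set ℓ
  PowAdj x y = ¬ (x ≈ y) × ((y ∈⟨ x ⟩) ⊎ (x ∈⟨ y ⟩))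

  -- enhanced power graph adjacency: <x, y> is cyclic, i.e. x, y lie in a common cyclic subgroup
  EnhAdj : Carrier → Carrier → Set (c ⊔ ℓ)
  EnhAdj x y = ¬ (x ≈ y) × (∃ λ z → (x ∈⟨ z ⟩) × (y ∈⟨ z ⟩))

  DEdge : Carrier → Carrier → Set (c ⊔ ℓ)
  DEdge x y = EnhAdj x y × ¬ (PowAdj x y)

  DVertex : Carrier → Set (c ⊔ ℓ)
  DVertex x = ∃ λ y → DEdge x y

  InNbhdClass : Carrier → Carrier → Set (c ⊔ ℓ)
  InNbhdClass v w = DVertex w × (∀ z → (DEdge v z → DEdge w z) × (DEdge w z → DEdge v z))

-- Write z ⊏ y for ⟨z⟩ ⊊ ⟨y⟩. As o(x) and o(y) are coprime, both components of (x , y) ∈ P × Q are powers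
-- of it, and the cyclic subgroups of a cyclic q-group form a chain; hence the D-neighbours of (e , y) are
-- exactly the (x , z) with x ≠ e and z ⊏ y. So (x , y) ∈ [(e , b)] iff x = e (otherwise (x , e), a power of
-- (x , y), would be a neighbour) and ⟨b⟩, ⟨y⟩ have the same proper cyclic subgroups. For o(b) = q^u the
-- largest of these is ⟨b^q⟩, so this happens iff o(y) = q^u, b^q ∈ ⟨y⟩ and y^q ∈ ⟨b⟩. Finally b^q ∈ ⟨y⟩
-- iff |⟨b⟩ ∩ ⟨y⟩| ≥ q^(u-1): the q^(u-1) powers of b^q are common elements, and conversely q^(u-1) common
-- elements cannot all lie in ⟨b^(q²)⟩, while every element of ⟨b⟩ outside it has b^q among its powers.

module Submission where

open import Defs
open import Level using (Level; _⊔_)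
open import Algebra.Bundles using (Group; AbelianGroup)
open import Algebra.Construct.DirectProduct using (group; abelianGroup)
open import Data.Fin using (Fin; toℕ; fromℕ<)
open import Data.Fin.Properties using (all?; ¬∀⟶∃¬; pigeonhole; toℕ-fromℕ<; toℕ<n; toℕ-injective)
open import Data.Nat using (ℕ; zero; suc; _+_; _*_; _∸_; _^_; _<_; _≤_; z<s; s<s; s≤s⁻¹; NonZero; NonTrivial; nonTrivial⇒n>1)
open import Data.Nat.Coprimality as Coprimality using (Coprime; coprime-Bézout; coprime-divisor)
open import Data.Nat.Divisibility using (_∣_; divides; _∣?_; ∣-trans; ∣1⇒≡1; quotient-<)
open import Data.Nat.DivMod using (_%_; _/_; m≡m%n+[m/n]*n; m%n<n)
open import Data.Nat.GCD using (module Bézout)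
open import Data.Nat.Induction using (<-wellFounded)
open import Data.Nat.Primality using (Prime; ¬prime[1]; prime⇒irreducible; prime⇒nonZero; prime⇒nonTrivial)
open import Data.Nat.Properties
open import Data.Product using (∃; _×_; _,_; proj₁; proj₂; swap)
open import Data.Sum using (_⊎_; inj₁; inj₂; [_,_]′)
open import Function using (_∘_; id)
open import Induction.WellFounded using (Acc; acc)
open import Relation.Binary.Definitions using (tri<; tri≈; tri>)
open import Relation.Binary.PropositionalEquality as ≡ using (_≡_; _≢_)
open import Relation.Nullary using (¬_; Dec; yes; no; contradiction)

private
  variable
    m n k : ℕ

prime∤⇒coprime : ∀ {q} → Prime q → ¬ q ∣ m → Coprime m q
prime∤⇒coprime q-prime q∤m (d∣m , d∣q) with prime⇒irreducible q-prime d∣q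
... | inj₁ d≡1    = d≡1
... | inj₂ ≡.refl = contradiction d∣m q∤m

coprime-^ʳ : Coprime m n → ∀ k → Coprime m (n ^ k)
coprime-^ʳ _ zero    (_ , d∣1)     = ∣1⇒≡1 d∣1
coprime-^ʳ c (suc k) (d∣m , d∣nnᵏ) =
  coprime-^ʳ c k (d∣m , coprime-divisor (λ (e∣d , e∣n) → c (∣-trans e∣d d∣m , e∣n)) d∣nnᵏ)

distinct-primes⇒coprime-^ : ∀ {p q} → Prime p → Prime q → p ≢ q → ∀ a b → Coprime (p ^ a) (q ^ b)
distinct-primes⇒coprime-^ {p} {q} p-prime q-prime p≢q a b =
  Coprimality.sym (coprime-^ʳ (Coprimality.sym (coprime-^ʳ (prime∤⇒coprime q-prime q∤p) b)) a)
  where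
  q∤p : ¬ q ∣ p
  q∤p q∣p with prime⇒irreducible p-prime q∣p
  ... | inj₁ ≡.refl = ¬prime[1] q-prime
  ... | inj₂ q≡p    = p≢q (≡.sym q≡p)

module Powers {c ℓ : Level} (G : Group c ℓ) where
  open Group G
  open GroupNotions G
  open import Algebra.Properties.Group G using (∙-cancelˡ)
  open import Algebra.Properties.Monoid.Mult monoid using (×-congʳ; ×-homo-+; ×-assocˡ) renaming (_×_ to _·_)
  open import Relation.Binary.Reasoning.Setoid setoid

  private
    variable
      x y g : Carrier

  pow≡· : ∀ x n → pow x n ≡ n · x
  pow≡· x zero    = ≡.refl
  pow≡· x (suc n) = ≡.cong (x ∙_) (pow≡· x n)

  pow-congˡ : ∀ n → x ≈ y → pow x n ≈ pow y n
  pow-congˡ {x} {y} n x≈y rewrite pow≡· x n | pow≡· y n = ×-congʳ n x≈y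

  pow-congʳ : ∀ x → m ≡ n → pow x m ≈ pow x n
  pow-congʳ x m≡n = reflexive (≡.cong (pow x) m≡n)

  pow-+ : ∀ x m n → pow x (m + n) ≈ pow x m ∙ pow x n
  pow-+ x m n rewrite pow≡· x (m + n) | pow≡· x m | pow≡· x n = ×-homo-+ x m n

  pow-pow : ∀ x m n → pow (pow x n) m ≈ pow x (m * n)
  pow-pow x m n rewrite pow≡· (pow x n) m | pow≡· x n | pow≡· x (m * n) = ×-assocˡ x m n

  pow-comm : ∀ x m n → pow (pow x n) m ≈ pow (pow x m) n
  pow-comm x m n = begin
    pow (pow x n) m  ≈⟨ pow-pow x m n ⟩
    pow x (m * n)    ≈⟨ pow-congʳ x (*-comm m n) ⟩
    pow x (n * m)    ≈⟨ pow-pow x n m ⟨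
    pow (pow x m) n  ∎

  pow-1 : ∀ x → pow x 1 ≈ x
  pow-1 = identityʳ

  pow-ε : ∀ n → pow ε n ≈ ε
  pow-ε zero    = refl
  pow-ε (suc n) = trans (identityˡ _) (pow-ε n)

  pow-multiple : pow x n ≈ ε → ∀ k → pow x (k * n) ≈ ε
  pow-multiple {x} {n} xⁿ≈ε k = begin
    pow x (k * n)    ≈⟨ pow-pow x k n ⟨
    pow (pow x n) k  ≈⟨ pow-congˡ k xⁿ≈ε ⟩
    pow ε k          ≈⟨ pow-ε k ⟩
    ε                ∎

  pow-1+multiple : pow x n ≈ ε → ∀ k → pow x (1 + k * n) ≈ x
  pow-1+multiple {x} {n} xⁿ≈ε k = begin
    pow x (1 + k * n)          ≈⟨ pow-+ x 1 (k * n) ⟩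
    pow x 1 ∙ pow x (k * n)    ≈⟨ ∙-cong (pow-1 x) (pow-multiple xⁿ≈ε k) ⟩
    x ∙ ε                      ≈⟨ identityʳ x ⟩
    x                          ∎

  pow-% : pow x n ≈ ε → .{{_ : NonZero n}} → ∀ m → pow x m ≈ pow x (m % n)
  pow-% {x} {n} xⁿ≈ε m = begin
    pow x m                            ≈⟨ pow-congʳ x (m≡m%n+[m/n]*n m n) ⟩
    pow x (m % n + (m / n) * n)        ≈⟨ pow-+ x (m % n) _ ⟩
    pow x (m % n) ∙ pow x (m / n * n)  ≈⟨ ∙-congˡ (pow-multiple xⁿ≈ε (m / n)) ⟩
    pow x (m % n) ∙ ε                  ≈⟨ identityʳ _ ⟩
    pow x (m % n)                      ∎

  HasOrder-resp : x ≈ y → HasOrder x n → HasOrder y n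
  HasOrder-resp {x} {y} {n} x≈y (0<n , xⁿ≈ε , minimal) =
    0<n , trans (pow-congˡ n (sym x≈y)) xⁿ≈ε ,
    λ m 0<m m<n yᵐ≈ε → minimal m 0<m m<n (trans (pow-congˡ m x≈y) yᵐ≈ε)

  HasOrder-1⇒≈ε : HasOrder x 1 → x ≈ ε
  HasOrder-1⇒≈ε {x} (_ , x¹≈ε , _) = trans (sym (pow-1 x)) x¹≈ε

  HasOrder->1⇒≉ε : HasOrder x n → 1 < n → ¬ x ≈ ε
  HasOrder->1⇒≉ε {x} (_ , _ , minimal) 1<n x≈ε = minimal 1 z<s 1<n (trans (pow-1 x) x≈ε)

  ≈ε? : HasOrder x n → Dec (x ≈ ε)
  ≈ε? {n = 1}           o = yes (HasOrder-1⇒≈ε o)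
  ≈ε? {n = suc (suc _)} o = no (HasOrder->1⇒≉ε o (s<s z<s))

  pow-distinct : HasOrder g n → m < k → k < n → ¬ pow g m ≈ pow g k
  pow-distinct {g} {n} {m} {k} (_ , _ , minimal) m<k k<n gᵐ≈gᵏ =
    minimal (k ∸ m) (m<n⇒0<n∸m m<k) (≤-<-trans (m∸n≤m k m) k<n) (sym (∙-cancelˡ (pow g m) _ _ gᵐε≈gᵐgᵏ⁻ᵐ))
    where
    gᵐε≈gᵐgᵏ⁻ᵐ : pow g m ∙ ε ≈ pow g m ∙ pow g (k ∸ m)
    gᵐε≈gᵐgᵏ⁻ᵐ = begin
      pow g m ∙ ε            ≈⟨ identityʳ _ ⟩
      pow g m                ≈⟨ gᵐ≈gᵏ ⟩
      pow g k                ≈⟨ pow-congʳ g (m+[n∸m]≡n (<⇒≤ m<k)) ⟨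
      pow g (m + (k ∸ m))    ≈⟨ pow-+ g m (k ∸ m) ⟩
      pow g m ∙ pow g (k ∸ m) ∎

  pow-injective : HasOrder g n → m < n → k < n → pow g m ≈ pow g k → m ≡ k
  pow-injective {m = m} {k} o m<n k<n gᵐ≈gᵏ with <-cmp m k
  ... | tri< m<k _ _ = contradiction gᵐ≈gᵏ (pow-distinct o m<k k<n)
  ... | tri≈ _ m≡k _ = m≡k
  ... | tri> _ _ k<m = contradiction (sym gᵐ≈gᵏ) (pow-distinct o k<m m<n)

module CyclicSubgroups {c ℓ : Level} (G : Group c ℓ) where
  open Group G
  open GroupNotions G
  open Powers G
  open import Algebra.Properties.Group G using (∙-cancelˡ)
  open import Relation.Binary.Reasoning.Setoid setoid

  private
    variable
      x y z g : Carrier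
      s : ℕ

  pow∈⟨⟩ : ∀ x n → pow x n ∈⟨ x ⟩
  pow∈⟨⟩ x n = n , refl

  ε∈⟨⟩ : ∀ x → ε ∈⟨ x ⟩
  ε∈⟨⟩ x = pow∈⟨⟩ x 0

  ∈⟨⟩-respˡ : y ≈ z → y ∈⟨ x ⟩ → z ∈⟨ x ⟩
  ∈⟨⟩-respˡ y≈z (n , y≈xⁿ) = n , trans (sym y≈z) y≈xⁿ

  ∈⟨⟩-respʳ : x ≈ y → z ∈⟨ x ⟩ → z ∈⟨ y ⟩
  ∈⟨⟩-respʳ x≈y (n , z≈xⁿ) = n , trans z≈xⁿ (pow-congˡ n x≈y)

  ∈⟨⟩-trans : z ∈⟨ y ⟩ → y ∈⟨ x ⟩ → z ∈⟨ x ⟩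
  ∈⟨⟩-trans {z} {y} {x} (n , z≈yⁿ) (m , y≈xᵐ) = n * m , (begin
    z                ≈⟨ z≈yⁿ ⟩
    pow y n          ≈⟨ pow-congˡ n y≈xᵐ ⟩
    pow (pow x m) n  ≈⟨ pow-pow x n m ⟩
    pow x (n * m)    ∎)

  ∙-∈⟨⟩ : y ∈⟨ x ⟩ → z ∈⟨ x ⟩ → (y ∙ z) ∈⟨ x ⟩
  ∙-∈⟨⟩ {x = x} (m , y≈xᵐ) (n , z≈xⁿ) = m + n , trans (∙-cong y≈xᵐ z≈xⁿ) (sym (pow-+ x m n))

  ∈⟨⟩-annihilated : pow x n ≈ ε → y ∈⟨ x ⟩ → pow y n ≈ ε
  ∈⟨⟩-annihilated {x} {n} {y} xⁿ≈ε (m , y≈xᵐ) = begin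
    pow y n          ≈⟨ pow-congˡ n y≈xᵐ ⟩
    pow (pow x m) n  ≈⟨ pow-comm x n m ⟩
    pow (pow x n) m  ≈⟨ pow-congˡ m xⁿ≈ε ⟩
    pow ε m          ≈⟨ pow-ε m ⟩
    ε                ∎

  ∉⟨⟩ : HasOrder x n → pow y m ≈ ε → 0 < m → m < n → ¬ x ∈⟨ y ⟩
  ∉⟨⟩ {m = m} (_ , _ , minimal) yᵐ≈ε 0<m m<n x∈⟨y⟩ = minimal m 0<m m<n (∈⟨⟩-annihilated {n = m} yᵐ≈ε x∈⟨y⟩)

  coprime⇒∈⟨pow⟩ : HasOrder x n → Coprime s n → x ∈⟨ pow x s ⟩
  coprime⇒∈⟨pow⟩ {x} {n} {s} (0<n , xⁿ≈ε , _) s⊥n with coprime-Bézout s⊥n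
  ... | Bézout.+- a b 1+bn≡as = a , (begin
    x                  ≈⟨ pow-1+multiple xⁿ≈ε b ⟨
    pow x (1 + b * n)  ≈⟨ pow-congʳ x 1+bn≡as ⟩
    pow x (a * s)      ≈⟨ pow-pow x a s ⟨
    pow (pow x s) a    ∎)
  ... | Bézout.-+ a b 1+as≡bn = r * a , sym (∙-cancelˡ (pow x r) _ _ xʳ⁺ʳᵃˢ≈xʳ⁺¹)
    where
    -- Since x ^ (1 + a s) ≈ ε, both x ^ (r a s) and x give ε when multiplied by x ^ r.
    r = n ∸ 1
    xʳ⁺ʳᵃˢ≈xʳ⁺¹ : pow x r ∙ pow (pow x s) (r * a) ≈ pow x r ∙ x
    xʳ⁺ʳᵃˢ≈xʳ⁺¹ = begin
      pow x r ∙ pow (pow x s) (r * a)  ≈⟨ ∙-congˡ (pow-pow x (r * a) s) ⟩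
      pow x r ∙ pow x (r * a * s)      ≈⟨ ∙-congˡ (pow-congʳ x (*-assoc r a s)) ⟩
      pow x r ∙ pow x (r * (a * s))    ≈⟨ pow-+ x r (r * (a * s)) ⟨
      pow x (r + r * (a * s))          ≈⟨ pow-congʳ x (*-suc r (a * s)) ⟨
      pow x (r * (1 + a * s))          ≈⟨ pow-congʳ x (≡.cong (r *_) 1+as≡bn) ⟩
      pow x (r * (b * n))              ≈⟨ pow-congʳ x (*-assoc r b n) ⟨
      pow x ((r * b) * n)              ≈⟨ pow-multiple xⁿ≈ε (r * b) ⟩
      ε                                ≈⟨ xⁿ≈ε ⟨
      pow x n                          ≈⟨ pow-congʳ x (m∸n+n≡m 0<n) ⟨
      pow x (r + 1)                    ≈⟨ pow-+ x r 1 ⟩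
      pow x r ∙ pow x 1                ≈⟨ ∙-congˡ (pow-1 x) ⟩
      pow x r ∙ x                      ∎

  AtLeast-mono : {S T : Carrier → Set ℓ} → (∀ {z} → S z → T z) → AtLeast S k → AtLeast T k
  AtLeast-mono S⊆T (f , f∈S , f-injective) = f , S⊆T ∘ f∈S , f-injective

  powers-AtLeast : HasOrder g n → AtLeast (_∈⟨ g ⟩) n
  powers-AtLeast {g} o =
    (λ i → pow g (toℕ i)) , (λ i → pow∈⟨⟩ g (toℕ i)) ,
    λ i j gⁱ≈gʲ → toℕ-injective (pow-injective o (toℕ<n i) (toℕ<n j) gⁱ≈gʲ)

  AtLeast-∈⟨⟩⇒≤ : pow g n ≈ ε → .{{_ : NonZero n}} → AtLeast (_∈⟨ g ⟩) k → k ≤ n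
  AtLeast-∈⟨⟩⇒≤ {g} {n} {k} gⁿ≈ε (f , f∈⟨g⟩ , f-injective) = ≮⇒≥ n≮k
    where
    exponent : Fin k → Fin n
    exponent i = fromℕ< (m%n<n (proj₁ (f∈⟨g⟩ i)) n)

    f≈pow-exponent : ∀ i → f i ≈ pow g (toℕ (exponent i))
    f≈pow-exponent i = begin
      f i                                  ≈⟨ proj₂ (f∈⟨g⟩ i) ⟩
      pow g (proj₁ (f∈⟨g⟩ i))              ≈⟨ pow-% gⁿ≈ε (proj₁ (f∈⟨g⟩ i)) ⟩
      pow g (proj₁ (f∈⟨g⟩ i) % n)          ≈⟨ pow-congʳ g (toℕ-fromℕ< (m%n<n (proj₁ (f∈⟨g⟩ i)) n)) ⟨
      pow g (toℕ (exponent i))             ∎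

    n≮k : ¬ n < k
    n≮k n<k with pigeonhole n<k exponent
    ... | i , j , i<j , eᵢ≡eⱼ = <-irrefl (≡.cong toℕ (f-injective i j fᵢ≈fⱼ)) i<j
      where
      fᵢ≈fⱼ : f i ≈ f j
      fᵢ≈fⱼ = begin
        f i                       ≈⟨ f≈pow-exponent i ⟩
        pow g (toℕ (exponent i))  ≈⟨ pow-congʳ g (≡.cong toℕ eᵢ≡eⱼ) ⟩
        pow g (toℕ (exponent j))  ≈⟨ f≈pow-exponent j ⟨
        f j                       ∎

  DEdge-respˡ : x ≈ y → DEdge x z → DEdge y z
  DEdge-respˡ x≈y ((x≉z , g , x∈⟨g⟩ , z∈⟨g⟩) , ¬x~z) =
    ((λ y≈z → x≉z (trans x≈y y≈z)) , g , ∈⟨⟩-respˡ x≈y x∈⟨g⟩ , z∈⟨g⟩) ,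
    λ (_ , y~z) → ¬x~z (x≉z , [ inj₁ ∘ ∈⟨⟩-respʳ (sym x≈y) , inj₂ ∘ ∈⟨⟩-respˡ (sym x≈y) ]′ y~z)

  InNbhdClass-respʳ : y ≈ z → InNbhdClass x y → InNbhdClass x z
  InNbhdClass-respʳ y≈z ((t , y-t) , same) =
    (t , DEdge-respˡ y≈z y-t) ,
    λ t → DEdge-respˡ y≈z ∘ proj₁ (same t) , proj₂ (same t) ∘ DEdge-respˡ (sym y≈z)

  _⊏_ : Carrier → Carrier → Set ℓ
  z ⊏ x = z ∈⟨ x ⟩ × ¬ x ∈⟨ z ⟩

  ∈⟨ε⟩⇒≈ε : x ∈⟨ ε ⟩ → x ≈ ε
  ∈⟨ε⟩⇒≈ε (n , x≈εⁿ) = trans x≈εⁿ (pow-ε n)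

  ε⊏ : ¬ x ≈ ε → ε ⊏ x
  ε⊏ {x} x≉ε = ε∈⟨⟩ x , x≉ε ∘ ∈⟨ε⟩⇒≈ε

  ⊏⇒≉ε : z ⊏ x → ¬ x ≈ ε
  ⊏⇒≉ε {z} (_ , x∉⟨z⟩) x≈ε = x∉⟨z⟩ (∈⟨⟩-respˡ (sym x≈ε) (ε∈⟨⟩ z))

  _≃⊏_ : Carrier → Carrier → Set (c ⊔ ℓ)
  x ≃⊏ y = ∀ z → (z ⊏ x → z ⊏ y) × (z ⊏ y → z ⊏ x)

module PrimePowerOrder {c ℓ : Level} (G : Group c ℓ) {q : ℕ} (q-prime : Prime q) where
  open Group G
  open GroupNotions G
  open Powers G
  open CyclicSubgroups G
  open import Relation.Binary.Reasoning.Setoid setoid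
  open import Data.Nat.Solver using (module +-*-Solver)
  open +-*-Solver using (solve; _:*_; _:=_)

  private
    instance
      q-nonZero : NonZero q
      q-nonZero = prime⇒nonZero q-prime
      q-nonTrivial : NonTrivial q
      q-nonTrivial = prime⇒nonTrivial q-prime

    variable
      x y z : Carrier
      s t u : ℕ

    1<q : 1 < q
    1<q = nonTrivial⇒n>1 q

    qᵏ<qᵏ⁺¹ : ∀ k → q ^ k < q ^ suc k
    qᵏ<qᵏ⁺¹ k = ^-monoʳ-< q 1<q (n<1+n k)

  HasOrder-pow-q : HasOrder x (q ^ suc u) → HasOrder (pow x q) (q ^ u)
  HasOrder-pow-q {x} {u} (_ , x^qᵘ⁺¹≈ε , minimal) =
    m^n>0 q u ,
    trans (pow-pow x (q ^ u) q) (trans (pow-congʳ x (*-comm (q ^ u) q)) x^qᵘ⁺¹≈ε) ,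
    λ m 0<m m<qᵘ xqᵐ≈ε →
      minimal (q * m) (≡.subst (_< q * m) (*-zeroʳ q) (*-monoʳ-< q 0<m)) (*-monoʳ-< q m<qᵘ)
        (trans (pow-congʳ x (*-comm q m)) (trans (sym (pow-pow x m q)) xqᵐ≈ε))

  ∤⇒∈⟨pow⟩ : HasOrder x (q ^ k) → ¬ q ∣ s → x ∈⟨ pow x s ⟩
  ∤⇒∈⟨pow⟩ {k = k} o q∤s = coprime⇒∈⟨pow⟩ o (coprime-^ʳ (prime∤⇒coprime q-prime q∤s) k)

  same-order⇒∈⟨pow⟩ : HasOrder x (q ^ k) → HasOrder (pow x n) (q ^ k) → x ∈⟨ pow x n ⟩
  same-order⇒∈⟨pow⟩ {x} {zero} {n} ox _ = ∈⟨⟩-respˡ (sym (HasOrder-1⇒≈ε ox)) (ε∈⟨⟩ (pow x n))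
  same-order⇒∈⟨pow⟩ {x} {suc j} {n} ox oxⁿ with q ∣? n
  ... | no q∤n = ∤⇒∈⟨pow⟩ {k = suc j} ox q∤n
  ... | yes (divides d n≡dq) = contradiction xⁿ^qʲ≈ε (proj₂ (proj₂ oxⁿ) (q ^ j) (m^n>0 q j) (qᵏ<qᵏ⁺¹ j))
    where
    xⁿ^qʲ≈ε : pow (pow x n) (q ^ j) ≈ ε
    xⁿ^qʲ≈ε = begin
      pow (pow x n) (q ^ j)      ≈⟨ pow-pow x (q ^ j) n ⟩
      pow x (q ^ j * n)          ≈⟨ pow-congʳ x (≡.cong (q ^ j *_) n≡dq) ⟩
      pow x (q ^ j * (d * q))    ≈⟨ pow-congʳ x (solve 3 (λ Q d q → Q :* (d :* q) := d :* (q :* Q)) ≡.refl (q ^ j) d q) ⟩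
      pow x (d * q ^ suc j)      ≈⟨ pow-multiple {n = q ^ suc j} (proj₁ (proj₂ ox)) d ⟩
      ε                          ∎

  ⊏⇒order< : HasOrder y (q ^ s) → HasOrder x (q ^ t) → y ⊏ x → s < t
  ⊏⇒order< {y} {s} {x} {t} oy ox ((n , y≈xⁿ) , x∉⟨y⟩) with <-cmp s t
  ... | tri< s<t _ _ = s<t
  ... | tri≈ _ ≡.refl _ =
    contradiction (∈⟨⟩-respʳ (sym y≈xⁿ) (same-order⇒∈⟨pow⟩ {k = s} {n} ox (HasOrder-resp {n = q ^ s} y≈xⁿ oy)))
                  x∉⟨y⟩
  ... | tri> _ _ t<s = contradiction y^qᵗ≈ε (proj₂ (proj₂ oy) (q ^ t) (m^n>0 q t) (^-monoʳ-< q 1<q t<s))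
    where
    y^qᵗ≈ε : pow y (q ^ t) ≈ ε
    y^qᵗ≈ε = ∈⟨⟩-annihilated {n = q ^ t} (proj₁ (proj₂ ox)) (n , y≈xⁿ)

  ⊏⇒∈⟨pow-q⟩ : HasOrder x (q ^ k) → z ⊏ x → z ∈⟨ pow x q ⟩
  ⊏⇒∈⟨pow-q⟩ {x} {k} {z} ox ((m , z≈xᵐ) , x∉⟨z⟩) with q ∣? m
  ... | no q∤m = contradiction (∈⟨⟩-respʳ (sym z≈xᵐ) (∤⇒∈⟨pow⟩ {k = k} ox q∤m)) x∉⟨z⟩
  ... | yes (divides d m≡dq) = d , (begin
    z                ≈⟨ z≈xᵐ ⟩
    pow x m          ≈⟨ pow-congʳ x m≡dq ⟩
    pow x (d * q)    ≈⟨ pow-pow x d q ⟨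
    pow (pow x q) d  ∎)

  q²∤⇒pow-q∈⟨pow⟩ : HasOrder x (q ^ suc u) → ¬ (q * q) ∣ m → pow x q ∈⟨ pow x m ⟩
  q²∤⇒pow-q∈⟨pow⟩ {x} {u} {m} ox q²∤m with q ∣? m
  ... | no q∤m = ∈⟨⟩-trans (pow∈⟨⟩ x q) (∤⇒∈⟨pow⟩ {k = suc u} ox q∤m)
  ... | yes (divides d m≡dq) =
    ∈⟨⟩-respʳ (trans (pow-pow x d q) (pow-congʳ x (≡.sym m≡dq))) (∤⇒∈⟨pow⟩ {k = u} (HasOrder-pow-q {u = u} ox) q∤d)
    where
    q∤d : ¬ q ∣ d
    q∤d (divides e d≡eq) = q²∤m (divides e (≡.trans m≡dq (≡.trans (≡.cong (_* q) d≡eq) (*-assoc e q q))))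

  -- If all exponents were divisible by q², the q ^ u elements would lie in ⟨x ^ q²⟩, which has only q ^ (u - 1).
  large-intersection⇒pow-q∈⟨⟩ : HasOrder x (q ^ suc u) → AtLeast (λ z → z ∈⟨ x ⟩ × z ∈⟨ y ⟩) (q ^ u) →
                                pow x q ∈⟨ y ⟩
  large-intersection⇒pow-q∈⟨⟩ {x} {zero} {y} (_ , x^q¹≈ε , _) _ =
    ∈⟨⟩-respˡ (sym (trans (pow-congʳ x (≡.sym (*-identityʳ q))) x^q¹≈ε)) (ε∈⟨⟩ y)
  large-intersection⇒pow-q∈⟨⟩ {x} {suc v} {y} ox (f , f∈⟨x⟩∩⟨y⟩ , f-injective) =
    by-cases (all? (λ i → (q * q) ∣? exponent i))
    where
    exponent : Fin (q ^ suc v) → ℕ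
    exponent i = proj₁ (proj₁ (f∈⟨x⟩∩⟨y⟩ i))

    f≈x^exponent : ∀ i → f i ≈ pow x (exponent i)
    f≈x^exponent i = proj₂ (proj₁ (f∈⟨x⟩∩⟨y⟩ i))

    x^q²^qᵛ≈ε : pow (pow x (q * q)) (q ^ v) ≈ ε
    x^q²^qᵛ≈ε = begin
      pow (pow x (q * q)) (q ^ v)  ≈⟨ pow-pow x (q ^ v) (q * q) ⟩
      pow x (q ^ v * (q * q))      ≈⟨ pow-congʳ x (solve 2 (λ Q q → Q :* (q :* q) := q :* (q :* Q)) ≡.refl (q ^ v) q) ⟩
      pow x (q ^ suc (suc v))      ≈⟨ proj₁ (proj₂ ox) ⟩
      ε                            ∎

    f∈⟨x^q²⟩ : (∀ i → (q * q) ∣ exponent i) → ∀ i → f i ∈⟨ pow x (q * q) ⟩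
    f∈⟨x^q²⟩ all-q²∣ i with all-q²∣ i
    ... | divides d eᵢ≡dq² = d , (begin
      f i                      ≈⟨ f≈x^exponent i ⟩
      pow x (exponent i)       ≈⟨ pow-congʳ x eᵢ≡dq² ⟩
      pow x (d * (q * q))      ≈⟨ pow-pow x d (q * q) ⟨
      pow (pow x (q * q)) d    ∎)

    by-cases : Dec (∀ i → (q * q) ∣ exponent i) → pow x q ∈⟨ y ⟩
    by-cases (yes all-q²∣) =
      contradiction (AtLeast-∈⟨⟩⇒≤ x^q²^qᵛ≈ε {{m^n≢0 q v}} (f , f∈⟨x^q²⟩ all-q²∣ , f-injective))
                    (<⇒≱ (qᵏ<qᵏ⁺¹ v))
    by-cases (no ¬all-q²∣) with ¬∀⟶∃¬ _ _ (λ i → (q * q) ∣? exponent i) ¬all-q²∣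
    ... | i , q²∤eᵢ =
      ∈⟨⟩-trans (∈⟨⟩-respʳ (sym (f≈x^exponent i)) (q²∤⇒pow-q∈⟨pow⟩ {u = suc v} ox q²∤eᵢ)) (proj₂ (f∈⟨x⟩∩⟨y⟩ i))

  pow-q∈⟨⟩⇒large-intersection : HasOrder x (q ^ suc u) → pow x q ∈⟨ y ⟩ →
                                AtLeast (λ z → z ∈⟨ x ⟩ × z ∈⟨ y ⟩) (q ^ u)
  pow-q∈⟨⟩⇒large-intersection {x} {u} ox xq∈⟨y⟩ =
    AtLeast-mono (λ {z} z∈⟨xq⟩ → ∈⟨⟩-trans {z} z∈⟨xq⟩ (pow∈⟨⟩ x q) , ∈⟨⟩-trans {z} z∈⟨xq⟩ xq∈⟨y⟩)
                 (powers-AtLeast (HasOrder-pow-q {u = u} ox))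

  annihilated⇒∉⟨⟩ : HasOrder x (q ^ suc u) → pow z (q ^ u) ≈ ε → ¬ x ∈⟨ z ⟩
  annihilated⇒∉⟨⟩ {u = u} ox z^qᵘ≈ε = ∉⟨⟩ {m = q ^ u} ox z^qᵘ≈ε (m^n>0 q u) (qᵏ<qᵏ⁺¹ u)

  pow-q⊏ : HasOrder x (q ^ suc u) → pow x q ⊏ x
  pow-q⊏ {x} {u} ox = pow∈⟨⟩ x q , annihilated⇒∉⟨⟩ {u = u} ox (proj₁ (proj₂ (HasOrder-pow-q {u = u} ox)))

  ⊏-transfer : HasOrder x (q ^ suc u) → HasOrder y (q ^ suc u) → pow x q ∈⟨ y ⟩ → z ⊏ x → z ⊏ y
  ⊏-transfer {x} {u} ox oy xq∈⟨y⟩ z⊏x =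
    ∈⟨⟩-trans z∈⟨xq⟩ xq∈⟨y⟩ ,
    annihilated⇒∉⟨⟩ {u = u} oy (∈⟨⟩-annihilated {n = q ^ u} (proj₁ (proj₂ (HasOrder-pow-q {u = u} ox))) z∈⟨xq⟩)
    where
    z∈⟨xq⟩ = ⊏⇒∈⟨pow-q⟩ {k = suc u} ox z⊏x

  same-order∧large-intersection⇒≃⊏ : HasOrder x (q ^ suc u) → HasOrder y (q ^ suc u) →
                                     AtLeast (λ z → z ∈⟨ x ⟩ × z ∈⟨ y ⟩) (q ^ u) → x ≃⊏ y
  same-order∧large-intersection⇒≃⊏ {u = u} ox oy (f , f∈∩ , f-injective) z =
    ⊏-transfer {u = u} ox oy (large-intersection⇒pow-q∈⟨⟩ {u = u} ox (f , f∈∩ , f-injective)) ,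
    ⊏-transfer {u = u} oy ox (large-intersection⇒pow-q∈⟨⟩ {u = u} oy (f , swap ∘ f∈∩ , f-injective))

  module _ (q-group : IsPGroup q) where

    -- Subgroups of a cyclic q-group form a chain: strip common factors q until one exponent is prime to q.
    pow-comparable : ∀ g m n → pow g n ∈⟨ pow g m ⟩ ⊎ pow g m ∈⟨ pow g n ⟩
    pow-comparable g m = go (<-wellFounded m) g
      where
      pow-pow-q : ∀ g {k} k′ → k ≡ k′ * q → pow (pow g q) k′ ≈ pow g k
      pow-pow-q g k′ k≡k′q = trans (pow-pow g k′ q) (pow-congʳ g (≡.sym k≡k′q))

      generates : ∀ g {k} → ¬ q ∣ k → g ∈⟨ pow g k ⟩
      generates g = ∤⇒∈⟨pow⟩ {k = proj₁ (q-group g)} (proj₂ (q-group g))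

      go : ∀ {m} → Acc _<_ m → ∀ g n → pow g n ∈⟨ pow g m ⟩ ⊎ pow g m ∈⟨ pow g n ⟩
      go {zero} _ g n = inj₂ (ε∈⟨⟩ (pow g n))
      go {suc m} (acc smaller) g n with q ∣? suc m | q ∣? n
      ... | no q∤m | _      = inj₁ (∈⟨⟩-trans (pow∈⟨⟩ g n) (generates g q∤m))
      ... | yes _  | no q∤n = inj₂ (∈⟨⟩-trans (pow∈⟨⟩ g (suc m)) (generates g q∤n))
      ... | yes q∣m@(divides m′ m≡m′q) | yes (divides n′ n≡n′q)
        with go (smaller (quotient-< q∣m)) (pow g q) n′
      ... | inj₁ n′∈m′ = inj₁ (∈⟨⟩-respˡ (pow-pow-q g n′ n≡n′q) (∈⟨⟩-respʳ (pow-pow-q g m′ m≡m′q) n′∈m′))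
      ... | inj₂ m′∈n′ = inj₂ (∈⟨⟩-respˡ (pow-pow-q g m′ m≡m′q) (∈⟨⟩-respʳ (pow-pow-q g n′ n≡n′q) m′∈n′))

    ∈⟨⟩-comparable : y ∈⟨ x ⟩ → z ∈⟨ x ⟩ → z ∈⟨ y ⟩ ⊎ y ∈⟨ z ⟩
    ∈⟨⟩-comparable {y} {x} {z} (m , y≈xᵐ) (n , z≈xⁿ) with pow-comparable x m n
    ... | inj₁ xⁿ∈⟨xᵐ⟩ = inj₁ (∈⟨⟩-respʳ (sym y≈xᵐ) (∈⟨⟩-respˡ (sym z≈xⁿ) xⁿ∈⟨xᵐ⟩))
    ... | inj₂ xᵐ∈⟨xⁿ⟩ = inj₂ (∈⟨⟩-respʳ (sym z≈xⁿ) (∈⟨⟩-respˡ (sym y≈xᵐ) xᵐ∈⟨xⁿ⟩))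

    ≃⊏⇒same-order∧large-intersection : HasOrder x (q ^ suc u) → x ≃⊏ y →
                                       HasOrder y (q ^ suc u) × AtLeast (λ z → z ∈⟨ x ⟩ × z ∈⟨ y ⟩) (q ^ u)
    ≃⊏⇒same-order∧large-intersection {x} {u} {y} ox x≃⊏y with q-group y
    ... | zero , oy = contradiction (HasOrder-1⇒≈ε oy) (⊏⇒≉ε xq⊏y)
      where xq⊏y = proj₁ (x≃⊏y (pow x q)) (pow-q⊏ {u = u} ox)
    ... | suc j , oy = ≡.subst (λ k → HasOrder y (q ^ suc k)) (≡.sym u≡j) oy ,
                       pow-q∈⟨⟩⇒large-intersection {u = u} ox (proj₁ xq⊏y)
      where
      xq⊏y = proj₁ (x≃⊏y (pow x q)) (pow-q⊏ {u = u} ox)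
      yq⊏x = proj₂ (x≃⊏y (pow y q)) (pow-q⊏ {u = j} oy)
      u≡j : u ≡ j
      u≡j = ≤-antisym (s≤s⁻¹ (⊏⇒order< (HasOrder-pow-q {u = u} ox) oy xq⊏y))
                      (s≤s⁻¹ (⊏⇒order< (HasOrder-pow-q {u = j} oy) ox yq⊏x))

module DirectProduct {c₁ ℓ₁ c₂ ℓ₂ : Level} {p q : ℕ} (p-prime : Prime p) (q-prime : Prime q) (p≢q : p ≢ q)
  (P : Group c₁ ℓ₁) (Q : Group c₂ ℓ₂)
  (P-p-group : GroupNotions.IsPGroup P p) (Q-q-group : GroupNotions.IsPGroup Q q) where

  private
    module P where
      open Group P public
      open GroupNotions P public
      open Powers P public
      open CyclicSubgroups P public

    module Q where
      open Group Q public
      open GroupNotions Q public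
      open Powers Q public
      open CyclicSubgroups Q public
      open PrimePowerOrder Q q-prime public

  open Group (group P Q)
  open GroupNotions (group P Q)
  open CyclicSubgroups (group P Q)

  private
    variable
      a x x′ w₁ : P.Carrier
      b y y′ z w₂ : Q.Carrier

  pow-× : ∀ x y n → pow (x , y) n ≈ (P.pow x n , Q.pow y n)
  pow-× x y zero    = P.refl , Q.refl
  pow-× x y (suc n) = P.∙-congˡ (proj₁ (pow-× x y n)) , Q.∙-congˡ (proj₂ (pow-× x y n))

  ∈⟨⟩-×⁺ : ∀ n → x P.≈ P.pow x′ n → y Q.≈ Q.pow y′ n → (x , y) ∈⟨ (x′ , y′) ⟩
  ∈⟨⟩-×⁺ {x′ = x′} {y′ = y′} n x≈x′ⁿ y≈y′ⁿ = n , trans (x≈x′ⁿ , y≈y′ⁿ) (sym (pow-× x′ y′ n))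

  ∈⟨⟩-×⁻ : (x , y) ∈⟨ (x′ , y′) ⟩ → x P.∈⟨ x′ ⟩ × y Q.∈⟨ y′ ⟩
  ∈⟨⟩-×⁻ {x′ = x′} {y′ = y′} (n , xy≈x′y′ⁿ) with trans xy≈x′y′ⁿ (pow-× x′ y′ n)
  ... | x≈x′ⁿ , y≈y′ⁿ = (n , x≈x′ⁿ) , (n , y≈y′ⁿ)

  ε×∈⟨ε×⟩ : y Q.∈⟨ y′ ⟩ → (P.ε , y) ∈⟨ (P.ε , y′) ⟩
  ε×∈⟨ε×⟩ (n , y≈y′ⁿ) = ∈⟨⟩-×⁺ n (P.sym (P.pow-ε n)) y≈y′ⁿ

  -- x ∈ ⟨x ^ qᵇ⟩ as qᵇ is prime to o(x) = pᵃ, while qᵇ annihilates y; and symmetrically for y.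
  x×ε∈⟨x×y⟩ : ∀ x y → (x , Q.ε) ∈⟨ (x , y) ⟩
  x×ε∈⟨x×y⟩ x y with P-p-group x | Q-q-group y
  ... | a , ox | b , (_ , y^qᵇ≈ε , _)
    with P.coprime⇒∈⟨pow⟩ ox (distinct-primes⇒coprime-^ q-prime p-prime (p≢q ∘ ≡.sym) b a)
  ... | t , x≈x^qᵇ^t =
    ∈⟨⟩-×⁺ (t * q ^ b) (P.trans x≈x^qᵇ^t (P.pow-pow x t (q ^ b))) (Q.sym (Q.pow-multiple {n = q ^ b} y^qᵇ≈ε t))

  ε×y∈⟨x×y⟩ : ∀ x y → (P.ε , y) ∈⟨ (x , y) ⟩
  ε×y∈⟨x×y⟩ x y with P-p-group x | Q-q-group y
  ... | a , (_ , x^pᵃ≈ε , _) | b , oy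
    with Q.coprime⇒∈⟨pow⟩ oy (distinct-primes⇒coprime-^ p-prime q-prime p≢q a b)
  ... | t , y≈y^pᵃ^t =
    ∈⟨⟩-×⁺ (t * p ^ a) (P.sym (P.pow-multiple {n = p ^ a} x^pᵃ≈ε t)) (Q.trans y≈y^pᵃ^t (Q.pow-pow y t (p ^ a)))

  DEdge⇒ : DEdge (P.ε , y) (x , z) → ¬ x P.≈ P.ε × z Q.⊏ y
  DEdge⇒ {y} {x} {z} ((εy≉xz , g , εy∈⟨g⟩ , xz∈⟨g⟩) , ¬εy~xz) = x≉ε , z∈⟨y⟩ , y∉⟨z⟩
    where
    y∉⟨z⟩ : ¬ y Q.∈⟨ z ⟩
    y∉⟨z⟩ y∈⟨z⟩ = ¬εy~xz (εy≉xz , inj₂ (∈⟨⟩-trans (ε×∈⟨ε×⟩ y∈⟨z⟩) (ε×y∈⟨x×y⟩ x z)))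

    z∈⟨y⟩ : z Q.∈⟨ y ⟩
    z∈⟨y⟩ = [ id , (λ y∈⟨z⟩ → contradiction y∈⟨z⟩ y∉⟨z⟩) ]′
              (Q.∈⟨⟩-comparable Q-q-group (proj₂ (∈⟨⟩-×⁻ εy∈⟨g⟩)) (proj₂ (∈⟨⟩-×⁻ xz∈⟨g⟩)))

    x≉ε : ¬ x P.≈ P.ε
    x≉ε x≈ε = ¬εy~xz (εy≉xz , inj₁ (∈⟨⟩-respˡ (P.sym x≈ε , Q.refl) (ε×∈⟨ε×⟩ z∈⟨y⟩)))

  ⇒DEdge : ¬ x P.≈ P.ε → z Q.⊏ y → DEdge (P.ε , y) (x , z)
  ⇒DEdge {x} {z} {y} x≉ε (z∈⟨y⟩ , y∉⟨z⟩) = (εy≉xz , (x , y) , ε×y∈⟨x×y⟩ x y , xz∈⟨xy⟩) , ¬εy~xz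
    where
    εy≉xz : ¬ (P.ε , y) ≈ (x , z)
    εy≉xz (ε≈x , _) = x≉ε (P.sym ε≈x)

    xz∈⟨xy⟩ : (x , z) ∈⟨ (x , y) ⟩
    xz∈⟨xy⟩ = ∈⟨⟩-respˡ (P.identityʳ x , Q.identityˡ z)
                (∙-∈⟨⟩ (x×ε∈⟨x×y⟩ x y) (∈⟨⟩-trans (ε×∈⟨ε×⟩ z∈⟨y⟩) (ε×y∈⟨x×y⟩ x y)))

    ¬εy~xz : ¬ PowAdj (P.ε , y) (x , z)
    ¬εy~xz (_ , inj₁ xz∈⟨εy⟩) = x≉ε (P.∈⟨ε⟩⇒≈ε (proj₁ (∈⟨⟩-×⁻ xz∈⟨εy⟩)))
    ¬εy~xz (_ , inj₂ εy∈⟨xz⟩) = y∉⟨z⟩ (proj₂ (∈⟨⟩-×⁻ εy∈⟨xz⟩))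

  InNbhdClass⇒ : ¬ b Q.≈ Q.ε → ¬ a P.≈ P.ε → InNbhdClass (P.ε , b) (w₁ , w₂) → w₁ P.≈ P.ε × b Q.≃⊏ w₂
  InNbhdClass⇒ {b} {a} {w₁} {w₂} b≉ε a≉ε (_ , same) = w₁≈ε , b≃⊏w₂
    where
    -- Otherwise (w₁ , ε) would be a neighbour of (ε , b), hence of w, yet it is a power of w.
    w₁≈ε : w₁ P.≈ P.ε
    w₁≈ε with P.≈ε? (proj₂ (P-p-group w₁))
    ... | yes w₁≈ε = w₁≈ε
    ... | no w₁≉ε = contradiction (εy≉xz , inj₁ (x×ε∈⟨x×y⟩ w₁ w₂)) ¬w~w₁ε
      where
      w-w₁ε = proj₁ (same (w₁ , Q.ε)) (⇒DEdge w₁≉ε (Q.ε⊏ b≉ε))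
      εy≉xz = proj₁ (proj₁ w-w₁ε)
      ¬w~w₁ε = proj₂ w-w₁ε

    w≈εw₂ : (w₁ , w₂) ≈ (P.ε , w₂)
    w≈εw₂ = w₁≈ε , Q.refl

    b≃⊏w₂ : b Q.≃⊏ w₂
    b≃⊏w₂ z =
      (λ z⊏b → proj₂ (DEdge⇒ (DEdge-respˡ w≈εw₂ (proj₁ (same (a , z)) (⇒DEdge a≉ε z⊏b))))) ,
      (λ z⊏w₂ → proj₂ (DEdge⇒ (proj₂ (same (a , z)) (DEdge-respˡ (sym w≈εw₂) (⇒DEdge a≉ε z⊏w₂)))))

  ≃⊏⇒InNbhdClass : ¬ b Q.≈ Q.ε → ¬ a P.≈ P.ε → b Q.≃⊏ y → InNbhdClass (P.ε , b) (P.ε , y)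
  ≃⊏⇒InNbhdClass {b} {a} {y} b≉ε a≉ε b≃⊏y =
    ((a , Q.ε) , ⇒DEdge a≉ε (proj₁ (b≃⊏y Q.ε) (Q.ε⊏ b≉ε))) ,
    λ (t₁ , t₂) → transfer (proj₁ (b≃⊏y t₂)) , transfer (proj₂ (b≃⊏y t₂))
    where
    transfer : ∀ {y y′ t₁ t₂} → (t₂ Q.⊏ y → t₂ Q.⊏ y′) → DEdge (P.ε , y) (t₁ , t₂) → DEdge (P.ε , y′) (t₁ , t₂)
    transfer ⊏y⇒⊏y′ e with DEdge⇒ e
    ... | t₁≉ε , t₂⊏y = ⇒DEdge t₁≉ε (⊏y⇒⊏y′ t₂⊏y)

lemma3p5 : {c ℓ : Level} (p q : ℕ) → Prime p → Prime q → ¬ (p ≡ q) →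
  (P Q : AbelianGroup c ℓ) →
  GroupNotions.IsFinite (AbelianGroup.group P) → GroupNotions.IsPGroup (AbelianGroup.group P) p →
  GroupNotions.IsFinite (AbelianGroup.group Q) → GroupNotions.IsPGroup (AbelianGroup.group Q) q →
  (∃ λ a → ¬ (AbelianGroup._≈_ P a (AbelianGroup.ε P))) →
  (b : AbelianGroup.Carrier Q) → ¬ (AbelianGroup._≈_ Q b (AbelianGroup.ε Q)) →
  (u : ℕ) → GroupNotions.HasOrder (AbelianGroup.group Q) b (q ^ u) →
  ∀ (w : AbelianGroup.Carrier (abelianGroup P Q)) →
    (GroupNotions.InNbhdClass (AbelianGroup.group (abelianGroup P Q)) (AbelianGroup.ε P , b) w
      → ∃ λ y → AbelianGroup._≈_ (abelianGroup P Q) w (AbelianGroup.ε P , y)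
                × GroupNotions.HasOrder (AbelianGroup.group Q) y (q ^ u)
                × GroupNotions.AtLeast (AbelianGroup.group Q)
                    (λ z → GroupNotions._∈⟨_⟩ (AbelianGroup.group Q) z b
                         × GroupNotions._∈⟨_⟩ (AbelianGroup.group Q) z y) (q ^ (u ∸ 1)))
    × ((∃ λ y → AbelianGroup._≈_ (abelianGroup P Q) w (AbelianGroup.ε P , y)
                × GroupNotions.HasOrder (AbelianGroup.group Q) y (q ^ u)
                × GroupNotions.AtLeast (AbelianGroup.group Q)
                    (λ z → GroupNotions._∈⟨_⟩ (AbelianGroup.group Q) z b
                         × GroupNotions._∈⟨_⟩ (AbelianGroup.group Q) z y) (q ^ (u ∸ 1)))
      → GroupNotions.InNbhdClass (AbelianGroup.group (abelianGroup P Q)) (AbelianGroup.ε P , b) w)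
lemma3p5 p q p-prime q-prime p≢q P Q _ _ _ _ _ b b≉ε zero ob _ =
  contradiction (Powers.HasOrder-1⇒≈ε (AbelianGroup.group Q) ob) b≉ε ,
  contradiction (Powers.HasOrder-1⇒≈ε (AbelianGroup.group Q) ob) b≉ε
lemma3p5 p q p-prime q-prime p≢q P Q _ P-p-group _ Q-q-group (a , a≉ε) b b≉ε (suc u) ob (w₁ , w₂) =
  (λ w∈[εb] →
    let w₁≈ε , b≃⊏w₂ = InNbhdClass⇒ b≉ε a≉ε w∈[εb]
        ow₂ , large-intersection = ≃⊏⇒same-order∧large-intersection Q-q-group {u = u} ob b≃⊏w₂
    in w₂ , (w₁≈ε , Group.refl Qᵍ) , ow₂ , large-intersection) ,
  (λ (y , w≈εy , oy , large-intersection) →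
    InNbhdClass-respʳ (Group.sym (group Pᵍ Qᵍ) w≈εy)
      (≃⊏⇒InNbhdClass b≉ε a≉ε (same-order∧large-intersection⇒≃⊏ {u = u} ob oy large-intersection)))
  where
  Pᵍ = AbelianGroup.group P
  Qᵍ = AbelianGroup.group Q
  open CyclicSubgroups (group Pᵍ Qᵍ) using (InNbhdClass-respʳ)
  open PrimePowerOrder Qᵍ q-prime using (≃⊏⇒same-order∧large-intersection; same-order∧large-intersection⇒≃⊏)
  open DirectProduct p-prime q-prime p≢q Pᵍ Qᵍ P-p-group Q-q-group using (InNbhdClass⇒; ≃⊏⇒InNbhdClass)
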